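{- Let $d\in\mathbb N\cup\{\infty\}$ and let $w\in\mathbb Z^{V_d}$ be a chip configuration such that every Pascal equation on $\mathbb Z^{V_d}$ vanishes at $w$. Then $w$ is an outcome.
   Context: $V_d=\{(i,j)\in\mathbb Z_{\geq0}^2\mid i+j\leq d\}$. A chip configuration is a finitely supported $w\in\mathbb Z^{V_d}$. A splitting move at $p\in V_{d-1}$ decreases $w_p$ by $1$ and increases $w_{p+(1,0)}$, $w_{p+(0,1)}$ by $1$; an unsplitting move is its inverse; an outcome is a configuration reachable from the zero configuration by finitely many moves. A Pascal equation is a linear form $w\mapsto\sum_{(i,j)\in V_d}c_{i,j}w_{i,j}$ with $c_{i,j}\in\mathbb Z$ satisfying $c_{i,j}=c_{i+1,j}+c_{i,j+1}$ for all $(i,j)\in V_{d-1}$. -}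

module Defs where

open import Data.Nat as ℕ using (ℕ; zero; suc; _∸_; _≟_)
import Data.Nat as N
open import Data.Integer using (ℤ; +_; _+_; _-_; _*_)
open import Data.Bool using (Bool; true; false; _∧_; if_then_else_)
open import Data.Product using (_×_; _,_; ∃-syntax)
open import Data.Unit using (⊤)
open import Data.List using (List; []; _∷_)
open import Data.List.Relation.Unary.All using (All)
open import Relation.Nullary using (¬_)
open import Relation.Nullary.Decidable using (⌊_⌋)
open import Relation.Binary.PropositionalEquality using (_≡_)

data ℕ∞ : Set where
  fin : ℕ → ℕ∞
  ∞   : ℕ∞

InV : ℕ∞ → ℕ → ℕ → Set
InV (fin d) i j = i N.+ j N.≤ d
InV ∞       i j = ⊤

-- (i , j) ∈ V_{d-1}  (V_{-1} = ∅, V_{∞-1} = V_∞)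
InV⁻ : ℕ∞ → ℕ → ℕ → Set
InV⁻ (fin d) i j = suc (i N.+ j) N.≤ d
InV⁻ ∞       i j = ⊤

-- Integer-valued functions on ℤ_{≥0}²; a configuration in ℤ^{V_d} is such a
-- function vanishing off V_d.
Grid : Set
Grid = ℕ → ℕ → ℤ

BoundedBy : ℕ → Grid → Set
BoundedBy N w = ∀ i j → N N.< i N.+ j → w i j ≡ + 0

ChipConfig : ℕ∞ → Grid → Set
ChipConfig d w = (∀ i j → ¬ InV d i j → w i j ≡ + 0) × ∃[ N ] BoundedBy N w

-- Pascal equation coefficients on V_d (values of c off V_d are irrelevant)
IsPascal : ℕ∞ → Grid → Set
IsPascal d c = ∀ i j → InV⁻ d i j → c i j ≡ c (suc i) j + c i (suc j)

diagSum : ℕ → ℕ → Grid → ℤ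
diagSum s zero    f = f 0 s
diagSum s (suc k) f = f (suc k) (s ∸ suc k) + diagSum s k f

triSum : ℕ → Grid → ℤ
triSum zero    f = diagSum 0 0 f
triSum (suc N) f = diagSum (suc N) (suc N) f + triSum N f

-- the Pascal equation with coefficients c evaluated at w, computed on any
-- triangle V_N containing the support of w
pairing : ℕ → Grid → Grid → ℤ
pairing N c w = triSum N (λ i j → c i j * w i j)

δ : ℕ → ℕ → Grid
δ i j k l = if ⌊ k ≟ i ⌋ ∧ ⌊ l ≟ j ⌋ then + 1 else + 0

-- a move: (true , p) = splitting at p, (false , p) = unsplitting at p
Move : Set
Move = Bool × ℕ × ℕ

applyMove : Move → Grid → Grid
applyMove (true  , i , j) w k l = w k l - δ i j k l + δ (suc i) j k l + δ i (suc j) k l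
applyMove (false , i , j) w k l = w k l + δ i j k l - δ (suc i) j k l - δ i (suc j) k l

applyMoves : List Move → Grid → Grid
applyMoves []       w = w
applyMoves (m ∷ ms) w = applyMove m (applyMoves ms w)

LegalMove : ℕ∞ → Move → Set
LegalMove d (_ , i , j) = InV⁻ d i j

Outcome : ℕ∞ → Grid → Set
Outcome d w = ∃[ ms ] (All (LegalMove d) ms × (∀ i j → applyMoves ms (λ _ _ → + 0) i j ≡ w i j))

-- Modulo outcomes, a split at (i , j) gives δ (i , j+1) ≡ δ (i , j) − δ (i+1 , j), so any
-- configuration supported in V_M is congruent to one supported on row 0 of V_M.  Pascal
-- equations vanish on outcomes, and the Pascal function whose row 0 is the indicator of (k , 0)
-- reads off the value at (k , 0) of a row-0 configuration.  Since all these equations vanish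
-- at w, its row-0 representative is zero, i.e. w is an outcome.
module Submission where

open import Defs
open import Data.Integer using (ℤ; +_)
open import Relation.Binary.PropositionalEquality using (_≡_)

open import Data.Bool using (true; false; not)
open import Data.Empty using (⊥-elim)
open import Data.Integer using (_+_; _-_; _*_; -_; -[1+_]; -1ℤ)
import Data.Integer.Properties as ℤP
open import Algebra.Properties.CommutativeSemigroup ℤP.+-commutativeSemigroup
  using () renaming (interchange to +-interchange)
open import Data.Integer.Tactic.RingSolver using (solve-∀)
open import Data.List using (_∷_; []; _++_; map)
open import Data.List.Relation.Unary.All as All using (All; []; _∷_)
import Data.List.Relation.Unary.All.Properties as All
open import Data.Nat as ℕ using (ℕ; zero; suc; _≤_; _<_; _∸_; z≤n)
import Data.Nat.Properties as ℕP
open import Data.Product using (_,_; _×_; ∃-syntax; proj₁)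
open import Data.Product.Properties using () renaming (≡-dec to ×-≡-dec)
open import Data.Unit using (tt)
open import Function using (_∘_)
open import Relation.Binary.PropositionalEquality using (refl; sym; trans; cong; cong₂; _≢_; module ≡-Reasoning)
open import Relation.Nullary using (Dec; yes; no)

open ≡-Reasoning

PointSupported : ℕ → ℕ → Grid → Set
PointSupported a b f = ∀ i j → (i , j) ≢ (a , b) → f i j ≡ + 0

δ-off : ∀ {a b i j} → (i , j) ≢ (a , b) → δ a b i j ≡ + 0
δ-off {a} {b} {i} {j} ne with i ℕ.≟ a | j ℕ.≟ b
... | yes refl | yes refl = ⊥-elim (ne refl)
... | yes _    | no _     = refl
... | no _     | _        = refl

δ-self : ∀ a b → δ a b a b ≡ + 1
δ-self a b with a ℕ.≟ a | b ℕ.≟ b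
... | yes _ | yes _ = refl
... | no ne | _     = ⊥-elim (ne refl)
... | yes _ | no ne = ⊥-elim (ne refl)

δ-sym : ∀ i j k l → δ i j k l ≡ δ k l i j
δ-sym i j k l = by-cases (×-≡-dec ℕ._≟_ ℕ._≟_ (k , l) (i , j))
  where
  by-cases : Dec ((k , l) ≡ (i , j)) → δ i j k l ≡ δ k l i j
  by-cases (yes refl) = refl
  by-cases (no ne)    = trans (δ-off ne) (sym (δ-off (ne ∘ sym)))

*δ-pointSupported : ∀ (F : Grid) a b → PointSupported a b (λ i j → F i j * δ a b i j)
*δ-pointSupported F a b i j ne = trans (cong (F i j *_) (δ-off ne)) (ℤP.*-zeroʳ (F i j))

diagSum-vanish : ∀ {s m f} → (∀ i → i ≤ m → f i (s ∸ i) ≡ + 0) → diagSum s m f ≡ + 0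
diagSum-vanish {m = zero}  h = h 0 z≤n
diagSum-vanish {s} {suc m} {f} h =
  cong₂ _+_ (h (suc m) ℕP.≤-refl) (diagSum-vanish {s} {f = f} (λ i i≤m → h i (ℕP.m≤n⇒m≤1+n i≤m)))

triSum-vanish : ∀ M {f : Grid} → (∀ i j → f i j ≡ + 0) → triSum M f ≡ + 0
triSum-vanish zero    {f} f≗0 = f≗0 0 0
triSum-vanish (suc M) {f} f≗0 =
  cong₂ _+_ (diagSum-vanish {suc M} {suc M} {f} λ i _ → f≗0 i (suc M ∸ i)) (triSum-vanish M f≗0)

module _ {a b : ℕ} {f : Grid} (supp : PointSupported a b f) where

  diagSum-below : ∀ s m → m < a → diagSum s m f ≡ + 0
  diagSum-below s m m<a = diagSum-vanish {s} {m} {f} λ i i≤m →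
    supp i (s ∸ i) λ e → ℕP.<-irrefl (cong proj₁ e) (ℕP.≤-<-trans i≤m m<a)

  diagSum-off : ∀ {s m} → a ℕ.+ b ≢ s → m ≤ s → diagSum s m f ≡ + 0
  diagSum-off {s} {m} ne m≤s = diagSum-vanish {s} {m} {f} λ i i≤m →
    supp i (s ∸ i) λ { refl → ne (ℕP.m+[n∸m]≡n (ℕP.≤-trans i≤m m≤s)) }

  diagSum-point : ∀ {s m} → a ≤ m → a ℕ.+ b ≡ s → diagSum s m f ≡ f a b
  diagSum-point {m = zero} z≤n refl = refl
  diagSum-point {s} {suc m} a≤1+m refl with a ℕ.≟ suc m
  ... | yes refl = begin
    f a (a ℕ.+ b ∸ a) + diagSum s m f
      ≡⟨ cong₂ _+_ (cong (f a) (ℕP.m+n∸m≡n a b)) (diagSum-below s m ℕP.≤-refl) ⟩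
    f a b + + 0
      ≡⟨ ℤP.+-identityʳ (f a b) ⟩
    f a b ∎
  ... | no a≢1+m = begin
    f (suc m) (s ∸ suc m) + diagSum s m f
      ≡⟨ cong₂ _+_ (supp _ _ (a≢1+m ∘ sym ∘ cong proj₁)) (diagSum-point (ℕP.≤-pred (ℕP.≤∧≢⇒< a≤1+m a≢1+m)) refl) ⟩
    + 0 + f a b
      ≡⟨ ℤP.+-identityˡ (f a b) ⟩
    f a b ∎

  triSum-outside : ∀ M → M < a ℕ.+ b → triSum M f ≡ + 0
  triSum-outside zero    M<a+b = diagSum-off (ℕP.<⇒≢ M<a+b ∘ sym) z≤n
  triSum-outside (suc M) M<a+b =
    cong₂ _+_ (diagSum-off (ℕP.<⇒≢ M<a+b ∘ sym) ℕP.≤-refl) (triSum-outside M (ℕP.<-trans (ℕP.n<1+n M) M<a+b))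

  triSum-point : ∀ M → a ℕ.+ b ≤ M → triSum M f ≡ f a b
  triSum-point zero a+b≤0 = diagSum-point (ℕP.≤-trans (ℕP.m≤m+n a b) a+b≤0) (ℕP.n≤0⇒n≡0 a+b≤0)
  triSum-point (suc M) a+b≤1+M with a ℕ.+ b ℕ.≟ suc M
  ... | yes e = trans (cong₂ _+_ (diagSum-point (ℕP.≤-trans (ℕP.m≤m+n a b) a+b≤1+M) e)
                                 (triSum-outside M (ℕP.≤-reflexive (sym e))))
                      (ℤP.+-identityʳ (f a b))
  ... | no ne = trans (cong₂ _+_ (diagSum-off ne ℕP.≤-refl) (triSum-point M (ℕP.≤-pred (ℕP.≤∧≢⇒< a+b≤1+M ne))))
                      (ℤP.+-identityˡ (f a b))

diagSum-cong : ∀ s m {f g : Grid} → (∀ i j → f i j ≡ g i j) → diagSum s m f ≡ diagSum s m g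
diagSum-cong s zero    f≗g = f≗g 0 s
diagSum-cong s (suc m) f≗g = cong₂ _+_ (f≗g (suc m) (s ∸ suc m)) (diagSum-cong s m f≗g)

triSum-cong : ∀ M {f g : Grid} → (∀ i j → f i j ≡ g i j) → triSum M f ≡ triSum M g
triSum-cong zero    f≗g = diagSum-cong 0 0 f≗g
triSum-cong (suc M) f≗g = cong₂ _+_ (diagSum-cong (suc M) (suc M) f≗g) (triSum-cong M f≗g)

diagSum-+ : ∀ s m (f g : Grid) → diagSum s m (λ i j → f i j + g i j) ≡ diagSum s m f + diagSum s m g
diagSum-+ s zero    f g = refl
diagSum-+ s (suc m) f g =
  trans (cong (_+_ (f i j + g i j)) (diagSum-+ s m f g)) (+-interchange (f i j) (g i j) (diagSum s m f) (diagSum s m g))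
  where i = suc m; j = s ∸ suc m

triSum-+ : ∀ M (f g : Grid) → triSum M (λ i j → f i j + g i j) ≡ triSum M f + triSum M g
triSum-+ zero    f g = diagSum-+ 0 0 f g
triSum-+ (suc M) f g = trans (cong₂ _+_ (diagSum-+ (suc M) (suc M) f g) (triSum-+ M f g))
  (+-interchange (diagSum (suc M) (suc M) f) (diagSum (suc M) (suc M) g) (triSum M f) (triSum M g))

diagSum-neg : ∀ s m (f : Grid) → diagSum s m (λ i j → - f i j) ≡ - diagSum s m f
diagSum-neg s zero    f = refl
diagSum-neg s (suc m) f =
  trans (cong (_+_ (- f i j)) (diagSum-neg s m f)) (sym (ℤP.neg-distrib-+ (f i j) (diagSum s m f)))
  where i = suc m; j = s ∸ suc m

triSum-neg : ∀ M (f : Grid) → triSum M (λ i j → - f i j) ≡ - triSum M f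
triSum-neg zero    f = diagSum-neg 0 0 f
triSum-neg (suc M) f = trans (cong₂ _+_ (diagSum-neg (suc M) (suc M) f) (triSum-neg M f))
  (sym (ℤP.neg-distrib-+ (diagSum (suc M) (suc M) f) (triSum M f)))

zeroGrid : Grid
zeroGrid _ _ = + 0

module _ (M : ℕ) (c : Grid) where

  pairing-cong : ∀ {v v′ : Grid} → (∀ k l → v k l ≡ v′ k l) → pairing M c v ≡ pairing M c v′
  pairing-cong v≗v′ = triSum-cong M λ i j → cong (c i j *_) (v≗v′ i j)

  pairing-+ : ∀ (v v′ : Grid) → pairing M c (λ k l → v k l + v′ k l) ≡ pairing M c v + pairing M c v′
  pairing-+ v v′ = trans (triSum-cong M λ i j → ℤP.*-distribˡ-+ (c i j) (v i j) (v′ i j)) (triSum-+ M _ _)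

  pairing-neg : ∀ (v : Grid) → pairing M c (λ k l → - v k l) ≡ - pairing M c v
  pairing-neg v = trans (triSum-cong M λ i j → sym (ℤP.neg-distribʳ-* (c i j) (v i j))) (triSum-neg M _)

  pairing-- : ∀ (v v′ : Grid) → pairing M c (λ k l → v k l - v′ k l) ≡ pairing M c v - pairing M c v′
  pairing-- v v′ = trans (pairing-+ v (λ k l → - v′ k l)) (cong (_+_ (pairing M c v)) (pairing-neg v′))

  pairing-zero : pairing M c zeroGrid ≡ + 0
  pairing-zero = triSum-vanish M λ i j → ℤP.*-zeroʳ (c i j)

  pairing-δ : ∀ {a b} → a ℕ.+ b ≤ M → pairing M c (δ a b) ≡ c a b
  pairing-δ {a} {b} a+b≤M = begin
    pairing M c (δ a b) ≡⟨ triSum-point (*δ-pointSupported c a b) M a+b≤M ⟩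
    c a b * δ a b a b   ≡⟨ cong (c a b *_) (δ-self a b) ⟩
    c a b * + 1         ≡⟨ ℤP.*-identityʳ (c a b) ⟩
    c a b               ∎

applyMove-translate : ∀ m (v : Grid) k l → applyMove m v k l ≡ v k l + applyMove m zeroGrid k l
applyMove-translate (true , i , j) v k l = shift (v k l) (δ i j k l) (δ (suc i) j k l) (δ i (suc j) k l)
  where
  shift : ∀ x a b e → x - a + b + e ≡ x + (+ 0 - a + b + e)
  shift = solve-∀
applyMove-translate (false , i , j) v k l = shift (v k l) (δ i j k l) (δ (suc i) j k l) (δ i (suc j) k l)
  where
  shift : ∀ x a b e → x + a - b - e ≡ x + (+ 0 + a - b - e)
  shift = solve-∀

applyMoves-translate : ∀ ms (v : Grid) k l → applyMoves ms v k l ≡ v k l + applyMoves ms zeroGrid k l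
applyMoves-translate []       v k l = sym (ℤP.+-identityʳ (v k l))
applyMoves-translate (m ∷ ms) v k l = begin
  applyMove m (applyMoves ms v) k l                   ≡⟨ applyMove-translate m (applyMoves ms v) k l ⟩
  applyMoves ms v k l + μ                             ≡⟨ cong (_+ μ) (applyMoves-translate ms v k l) ⟩
  v k l + applyMoves ms zeroGrid k l + μ              ≡⟨ ℤP.+-assoc (v k l) _ μ ⟩
  v k l + (applyMoves ms zeroGrid k l + μ)            ≡⟨ cong (_+_ (v k l)) (sym (applyMove-translate m (applyMoves ms zeroGrid) k l)) ⟩
  v k l + applyMove m (applyMoves ms zeroGrid) k l    ∎
  where μ = applyMove m zeroGrid k l

applyMoves-++ : ∀ xs ys (v : Grid) → applyMoves (xs ++ ys) v ≡ applyMoves xs (applyMoves ys v)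
applyMoves-++ []       ys v = refl
applyMoves-++ (x ∷ xs) ys v = cong (applyMove x) (applyMoves-++ xs ys v)

flipMove : Move → Move
flipMove (b , p) = not b , p

applyMove-flip : ∀ m k l → applyMove (flipMove m) zeroGrid k l ≡ - applyMove m zeroGrid k l
applyMove-flip (true , i , j) k l = negate (δ i j k l) (δ (suc i) j k l) (δ i (suc j) k l)
  where
  negate : ∀ a b e → + 0 + a - b - e ≡ - (+ 0 - a + b + e)
  negate = solve-∀
applyMove-flip (false , i , j) k l = negate (δ i j k l) (δ (suc i) j k l) (δ i (suc j) k l)
  where
  negate : ∀ a b e → + 0 - a + b + e ≡ - (+ 0 + a - b - e)
  negate = solve-∀

applyMoves-flip : ∀ ms k l → applyMoves (map flipMove ms) zeroGrid k l ≡ - applyMoves ms zeroGrid k l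
applyMoves-flip []       k l = refl
applyMoves-flip (m ∷ ms) k l = begin
  applyMove (flipMove m) (applyMoves (map flipMove ms) zeroGrid) k l
    ≡⟨ applyMove-translate (flipMove m) _ k l ⟩
  applyMoves (map flipMove ms) zeroGrid k l + applyMove (flipMove m) zeroGrid k l
    ≡⟨ cong₂ _+_ (applyMoves-flip ms k l) (applyMove-flip m k l) ⟩
  - applyMoves ms zeroGrid k l + - applyMove m zeroGrid k l
    ≡⟨ ℤP.neg-distrib-+ (applyMoves ms zeroGrid k l) (applyMove m zeroGrid k l) ⟨
  - (applyMoves ms zeroGrid k l + applyMove m zeroGrid k l)
    ≡⟨ cong -_ (applyMove-translate m (applyMoves ms zeroGrid) k l) ⟨
  - applyMove m (applyMoves ms zeroGrid) k l
    ∎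

module _ {d : ℕ∞} where

  Outcome-cong : ∀ {g h : Grid} → (∀ k l → g k l ≡ h k l) → Outcome d g → Outcome d h
  Outcome-cong g≗h (ms , legal , reach) = ms , legal , λ k l → trans (reach k l) (g≗h k l)

  Outcome-zero : Outcome d zeroGrid
  Outcome-zero = [] , [] , λ _ _ → refl

  Outcome-move : ∀ {m} → LegalMove d m → Outcome d (applyMove m zeroGrid)
  Outcome-move {m} legal = m ∷ [] , legal ∷ [] , λ _ _ → refl

  Outcome-+ : ∀ {g h : Grid} → Outcome d g → Outcome d h → Outcome d (λ k l → g k l + h k l)
  Outcome-+ {g} {h} (ms , legal , reach) (ns , legal′ , reach′) =
    ms ++ ns , All.++⁺ legal legal′ , λ k l → begin
      applyMoves (ms ++ ns) zeroGrid k l                    ≡⟨ cong (λ v → v k l) (applyMoves-++ ms ns zeroGrid) ⟩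
      applyMoves ms (applyMoves ns zeroGrid) k l            ≡⟨ applyMoves-translate ms (applyMoves ns zeroGrid) k l ⟩
      applyMoves ns zeroGrid k l + applyMoves ms zeroGrid k l ≡⟨ cong₂ _+_ (reach′ k l) (reach k l) ⟩
      h k l + g k l                                         ≡⟨ ℤP.+-comm (h k l) (g k l) ⟩
      g k l + h k l                                         ∎

  Outcome-neg : ∀ {g : Grid} → Outcome d g → Outcome d (λ k l → - g k l)
  Outcome-neg (ms , legal , reach) =
    map flipMove ms , All.map⁺ legal , λ k l → trans (applyMoves-flip ms k l) (cong -_ (reach k l))

  Outcome-*ℕ : ∀ n {g : Grid} → Outcome d g → Outcome d (λ k l → + n * g k l)
  Outcome-*ℕ zero    {g} _  = Outcome-cong (λ k l → sym (ℤP.*-zeroˡ (g k l))) Outcome-zero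
  Outcome-*ℕ (suc n) {g} og = Outcome-cong (λ k l → sym (ℤP.suc-* (+ n) (g k l))) (Outcome-+ og (Outcome-*ℕ n og))

  Outcome-* : ∀ x {g : Grid} → Outcome d g → Outcome d (λ k l → x * g k l)
  Outcome-* (+ n)      og = Outcome-*ℕ n og
  Outcome-* (-[1+ n ]) {g} og =
    Outcome-cong (λ k l → ℤP.neg-distribˡ-* (+ suc n) (g k l)) (Outcome-neg (Outcome-*ℕ (suc n) og))

Outcome-mono : ∀ {d d′ g} → (∀ m → LegalMove d m → LegalMove d′ m) → Outcome d g → Outcome d′ g
Outcome-mono d⊆d′ (ms , legal , reach) = ms , All.map (λ {m} → d⊆d′ m) legal , reach

module _ {M : ℕ} {c : Grid} (pascal : IsPascal (fin M) c) where

  pairing-split : ∀ {i j} → LegalMove (fin M) (true , i , j) → pairing M c (applyMove (true , i , j) zeroGrid) ≡ + 0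
  pairing-split {i} {j} legal = begin
    pairing M c (λ k l → zeroGrid k l - δ i j k l + δ (suc i) j k l + δ i (suc j) k l)
      ≡⟨ pairing-+ M c (λ k l → zeroGrid k l - δ i j k l + δ (suc i) j k l) (δ i (suc j)) ⟩
    pairing M c (λ k l → zeroGrid k l - δ i j k l + δ (suc i) j k l) + pairing M c (δ i (suc j))
      ≡⟨ cong (_+ pairing M c (δ i (suc j))) (pairing-+ M c (λ k l → zeroGrid k l - δ i j k l) (δ (suc i) j)) ⟩
    pairing M c (λ k l → zeroGrid k l - δ i j k l) + pairing M c (δ (suc i) j) + pairing M c (δ i (suc j))
      ≡⟨ cong₂ _+_ (cong₂ _+_ (pairing-- M c zeroGrid (δ i j)) (pairing-δ M c legal)) (pairing-δ M c i+[1+j]≤M) ⟩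
    pairing M c zeroGrid - pairing M c (δ i j) + c (suc i) j + c i (suc j)
      ≡⟨ cong (λ t → t + c (suc i) j + c i (suc j)) (cong₂ _-_ (pairing-zero M c) (pairing-δ M c i+j≤M)) ⟩
    + 0 - c i j + c (suc i) j + c i (suc j)
      ≡⟨ cong (λ t → + 0 - t + c (suc i) j + c i (suc j)) (pascal i j legal) ⟩
    + 0 - (c (suc i) j + c i (suc j)) + c (suc i) j + c i (suc j)
      ≡⟨ cancel (c (suc i) j) (c i (suc j)) ⟩
    + 0 ∎
    where
    i+j≤M : i ℕ.+ j ≤ M
    i+j≤M = ℕP.<⇒≤ legal
    i+[1+j]≤M : i ℕ.+ suc j ≤ M
    i+[1+j]≤M = ℕP.≤-trans (ℕP.≤-reflexive (ℕP.+-suc i j)) legal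
    cancel : ∀ x y → + 0 - (x + y) + x + y ≡ + 0
    cancel = solve-∀

  pairing-move : ∀ {m} → LegalMove (fin M) m → pairing M c (applyMove m zeroGrid) ≡ + 0
  pairing-move {true , i , j}  legal = pairing-split legal
  pairing-move {false , i , j} legal = begin
    pairing M c (applyMove (flipMove (true , i , j)) zeroGrid)   ≡⟨ pairing-cong M c (applyMove-flip (true , i , j)) ⟩
    pairing M c (λ k l → - applyMove (true , i , j) zeroGrid k l) ≡⟨ pairing-neg M c _ ⟩
    - pairing M c (applyMove (true , i , j) zeroGrid)            ≡⟨ cong -_ (pairing-split legal) ⟩
    + 0                                                           ∎

  pairing-applyMoves : ∀ {ms} → All (LegalMove (fin M)) ms → pairing M c (applyMoves ms zeroGrid) ≡ + 0
  pairing-applyMoves []                        = pairing-zero M c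
  pairing-applyMoves {m ∷ ms} (legal ∷ legals) = begin
    pairing M c (applyMove m (applyMoves ms zeroGrid))
      ≡⟨ pairing-cong M c (applyMove-translate m (applyMoves ms zeroGrid)) ⟩
    pairing M c (λ k l → applyMoves ms zeroGrid k l + applyMove m zeroGrid k l)
      ≡⟨ pairing-+ M c (applyMoves ms zeroGrid) (applyMove m zeroGrid) ⟩
    pairing M c (applyMoves ms zeroGrid) + pairing M c (applyMove m zeroGrid)
      ≡⟨ cong₂ _+_ (pairing-applyMoves legals) (pairing-move {m} legal) ⟩
    + 0 ∎

  pairing-outcome : ∀ {g} → Outcome (fin M) g → pairing M c g ≡ + 0
  pairing-outcome (ms , legals , reach) = trans (pairing-cong M c (λ k l → sym (reach k l))) (pairing-applyMoves legals)

OnRow0 : Grid → Set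
OnRow0 r = ∀ k l → r k (suc l) ≡ + 0

record RowReducible (M : ℕ) (g : Grid) : Set where
  constructor reduce
  field
    residue          : Grid
    residue-onRow0   : OnRow0 residue
    residue-bounded  : BoundedBy M residue
    residue-outcome  : Outcome (fin M) (λ k l → g k l - residue k l)

module _ {M : ℕ} where

  RowReducible-cong : ∀ {g h : Grid} → (∀ k l → g k l ≡ h k l) → RowReducible M g → RowReducible M h
  RowReducible-cong g≗h (reduce r row0 bounded og) =
    reduce r row0 bounded (Outcome-cong (λ k l → cong (_- r k l) (g≗h k l)) og)

  RowReducible-onRow0 : ∀ {g} → OnRow0 g → BoundedBy M g → RowReducible M g
  RowReducible-onRow0 {g} row0 bounded =
    reduce g row0 bounded (Outcome-cong (λ k l → sym (ℤP.+-inverseʳ (g k l))) Outcome-zero)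

  RowReducible-outcome : ∀ {g} → Outcome (fin M) g → RowReducible M g
  RowReducible-outcome {g} og =
    reduce zeroGrid (λ _ _ → refl) (λ _ _ _ → refl) (Outcome-cong (λ k l → sym (ℤP.+-identityʳ (g k l))) og)

  RowReducible-+ : ∀ {g h : Grid} → RowReducible M g → RowReducible M h → RowReducible M (λ k l → g k l + h k l)
  RowReducible-+ {g} {h} (reduce r row0 bounded og) (reduce r′ row0′ bounded′ oh) =
    reduce (λ k l → r k l + r′ k l)
      (λ k l → cong₂ _+_ (row0 k l) (row0′ k l))
      (λ i j M<i+j → cong₂ _+_ (bounded i j M<i+j) (bounded′ i j M<i+j))
      (Outcome-cong (λ k l → regroup (g k l) (r k l) (h k l) (r′ k l)) (Outcome-+ og oh))
    where
    regroup : ∀ x y x′ y′ → (x - y) + (x′ - y′) ≡ (x + x′) - (y + y′)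
    regroup = solve-∀

  RowReducible-* : ∀ x {g : Grid} → RowReducible M g → RowReducible M (λ k l → x * g k l)
  RowReducible-* x {g} (reduce r row0 bounded og) =
    reduce (λ k l → x * r k l)
      (λ k l → trans (cong (x *_) (row0 k l)) (ℤP.*-zeroʳ x))
      (λ i j M<i+j → trans (cong (x *_) (bounded i j M<i+j)) (ℤP.*-zeroʳ x))
      (Outcome-cong (λ k l → distrib x (g k l) (r k l)) (Outcome-* x og))
    where
    distrib : ∀ x y z → x * (y - z) ≡ x * y - x * z
    distrib = solve-∀

  RowReducible-δ : ∀ i j → i ℕ.+ j ≤ M → RowReducible M (δ i j)
  RowReducible-δ i zero i+0≤M = RowReducible-onRow0 (λ k l → δ-off {i} {0} {k} {suc l} (λ ())) bounded
    where
    bounded : BoundedBy M (δ i 0)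
    bounded k l M<k+l = δ-off {i} {0} {k} {l} λ { refl → ℕP.<⇒≱ M<k+l i+0≤M }
  RowReducible-δ i (suc j) i+[1+j]≤M =
    RowReducible-cong (λ k l → unsplit (δ i j k l) (δ (suc i) j k l) (δ i (suc j) k l))
      (RowReducible-+ (RowReducible-+ (RowReducible-δ i j i+j≤M) (RowReducible-* -1ℤ (RowReducible-δ (suc i) j legal)))
                      (RowReducible-outcome (Outcome-move {m = true , i , j} legal)))
    where
    legal : suc (i ℕ.+ j) ≤ M
    legal = ℕP.≤-trans (ℕP.≤-reflexive (sym (ℕP.+-suc i j))) i+[1+j]≤M
    i+j≤M : i ℕ.+ j ≤ M
    i+j≤M = ℕP.<⇒≤ legal
    unsplit : ∀ a b e → a + -1ℤ * b + (+ 0 - a + b + e) ≡ e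
    unsplit = solve-∀

  RowReducible-diagSum : ∀ {H : ℕ → ℕ → Grid} → (∀ i j → RowReducible M (H i j)) →
                         ∀ s m → RowReducible M (λ k l → diagSum s m (λ i j → H i j k l))
  RowReducible-diagSum reducible s zero    = reducible 0 s
  RowReducible-diagSum reducible s (suc m) =
    RowReducible-+ (reducible (suc m) (s ∸ suc m)) (RowReducible-diagSum reducible s m)

  RowReducible-triSum : ∀ {H : ℕ → ℕ → Grid} → (∀ i j → RowReducible M (H i j)) →
                        ∀ N → RowReducible M (λ k l → triSum N (λ i j → H i j k l))
  RowReducible-triSum reducible zero    = RowReducible-diagSum reducible 0 0
  RowReducible-triSum reducible (suc N) =
    RowReducible-+ (RowReducible-diagSum reducible (suc N) (suc N)) (RowReducible-triSum reducible N)

δ-expansion : ∀ M {w : Grid} → BoundedBy M w → ∀ k l → triSum M (λ i j → w i j * δ i j k l) ≡ w k l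
δ-expansion M {w} bounded k l with k ℕ.+ l ℕ.≤? M
... | yes k+l≤M = trans (triSum-cong M λ i j → cong (w i j *_) (δ-sym i j k l)) (begin
  triSum M (λ i j → w i j * δ k l i j) ≡⟨ triSum-point (*δ-pointSupported w k l) M k+l≤M ⟩
  w k l * δ k l k l                    ≡⟨ cong (w k l *_) (δ-self k l) ⟩
  w k l * + 1                          ≡⟨ ℤP.*-identityʳ (w k l) ⟩
  w k l                                ∎)
... | no  k+l≰M = trans (triSum-cong M λ i j → cong (w i j *_) (δ-sym i j k l))
                        (trans (triSum-outside (*δ-pointSupported w k l) M M<k+l) (sym (bounded k l M<k+l)))
  where M<k+l = ℕP.≰⇒> k+l≰M

RowReducible-bounded : ∀ M {w : Grid} → BoundedBy M w → RowReducible M w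
RowReducible-bounded M {w} bounded =
  RowReducible-cong (δ-expansion M bounded) (RowReducible-triSum {H = λ i j k l → w i j * δ i j k l} term M)
  where
  term : ∀ i j → RowReducible M (λ k l → w i j * δ i j k l)
  term i j with i ℕ.+ j ℕ.≤? M
  ... | yes i+j≤M = RowReducible-* (w i j) (RowReducible-δ i j i+j≤M)
  ... | no  i+j≰M = RowReducible-outcome (Outcome-cong (λ k l → cong (_* δ i j k l) (sym (bounded i j (ℕP.≰⇒> i+j≰M)))) Outcome-zero)

pascalExtension : (ℕ → ℤ) → Grid
pascalExtension f i zero    = f i
pascalExtension f i (suc j) = pascalExtension f i j - pascalExtension f (suc i) j

pascalExtension-isPascal : ∀ d f → IsPascal d (pascalExtension f)
pascalExtension-isPascal d f i j _ = split (pascalExtension f i j) (pascalExtension f (suc i) j)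
  where
  split : ∀ x y → x ≡ y + (x - y)
  split = solve-∀

rowTest : ℕ → Grid
rowTest k = pascalExtension (λ i → δ k 0 i 0)

pairing-rowTest : ∀ M k {r : Grid} → OnRow0 r → k ≤ M → pairing M (rowTest k) r ≡ r k 0
pairing-rowTest M k {r} row0 k≤M =
  trans (triSum-cong M agree) (pairing-δ M r (ℕP.≤-trans (ℕP.≤-reflexive (ℕP.+-identityʳ k)) k≤M))
  where
  agree : ∀ i j → rowTest k i j * r i j ≡ r i j * δ k 0 i j
  agree i zero    = ℤP.*-comm (δ k 0 i 0) (r i 0)
  agree i (suc j) = begin
    rowTest k i (suc j) * r i (suc j) ≡⟨ cong (rowTest k i (suc j) *_) (row0 i j) ⟩
    rowTest k i (suc j) * + 0         ≡⟨ ℤP.*-zeroʳ (rowTest k i (suc j)) ⟩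
    + 0                               ≡⟨ cong (_* δ k 0 i (suc j)) (row0 i j) ⟨
    r i (suc j) * δ k 0 i (suc j)     ∎

outcome-of-rowTests : ∀ M {w : Grid} → BoundedBy M w → (∀ k → pairing M (rowTest k) w ≡ + 0) → Outcome (fin M) w
outcome-of-rowTests M {w} bounded annihilated =
  Outcome-cong (λ k l → trans (cong (_-_ (w k l)) (residue≡0 k l)) (ℤP.+-identityʳ (w k l))) og
  where
  open RowReducible (RowReducible-bounded M bounded) renaming (residue to r; residue-outcome to og)
  residue≡0 : ∀ k l → r k l ≡ + 0
  residue≡0 k (suc l) = residue-onRow0 k l
  residue≡0 k zero with k ℕ.≤? M
  ... | no  k≰M = residue-bounded k 0 (ℕP.≤-trans (ℕP.≰⇒> k≰M) (ℕP.≤-reflexive (sym (ℕP.+-identityʳ k))))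
  ... | yes k≤M = begin
    r k 0                                                ≡⟨ pairing-rowTest M k residue-onRow0 k≤M ⟨
    pairing M c r                                        ≡⟨ pairing-cong M c (λ k l → difference (w k l) (r k l)) ⟩
    pairing M c (λ k l → w k l - (w k l - r k l))        ≡⟨ pairing-- M c w (λ k l → w k l - r k l) ⟩
    pairing M c w - pairing M c (λ k l → w k l - r k l)  ≡⟨ cong₂ _-_ (annihilated k) (pairing-outcome (pascalExtension-isPascal (fin M) _) og) ⟩
    + 0                                                  ∎
    where
    c = rowTest k
    difference : ∀ x y → y ≡ x - (x - y)
    difference = solve-∀

boundingTriangle : ∀ {d w} → ChipConfig d w → ∃[ M ] BoundedBy M w × (∀ m → LegalMove (fin M) m → LegalMove d m)
boundingTriangle {fin n} (outside , _) = n , (λ i j n<i+j → outside i j (ℕP.<⇒≱ n<i+j)) , λ _ legal → legal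
boundingTriangle {∞}     (_ , N , bounded) = N , bounded , λ _ _ → tt

proposition3p12 : (d : ℕ∞) (w : Grid) → ChipConfig d w →
    (∀ c → IsPascal d c → ∀ N → BoundedBy N w → pairing N c w ≡ + 0) →
    Outcome d w
proposition3p12 d w chip annihilated with boundingTriangle chip
... | M , bounded , legal-mono =
  Outcome-mono legal-mono
    (outcome-of-rowTests M bounded λ k → annihilated (rowTest k) (pascalExtension-isPascal d _) M bounded)
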